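{- Let $\mathcal{T}$ be a $\mathcal{TEL}^{\bigcirc}$-TBox and let $\mathcal{T}_{\mathit{rig}}$ be obtained from it as described in the context. For any concept names $A,B$ occurring in $\mathcal{T}$ and any $n\in\mathbb{Z}$, $\mathcal{T}\models A\sqsubseteq\bigcirc^nB$ if and only if $\mathcal{T}_{\mathit{rig}}\models A\sqsubseteq\bigcirc^nB$.
   Context: A $\mathcal{TEL}^{\bigcirc}$-TBox is a finite set of concept inclusions $A\sqsubseteq\bigcirc^nB$, $A\sqcap A'\sqsubseteq B$, $\exists r.A\sqsubseteq B$, $A\sqsubseteq\exists r.B$ ($A,A',B$ concept names, $r$ a role name, either rigid or local, $n\in\mathbb{Z}$, $\bigcirc^0B=B$). Semantics: an interpretation is a family $(\mathcal{I}_i)_{i\in\mathbb{Z}}$ of classical DL interpretations over a common domain (individual names interpreted as themselves), with rigid role names interpreted identically at all $i$; $(\bigcirc^nA)^{i}=A^{i+n}$, $\sqcap$ is intersection, $(\exists r.A)^i=\{d\mid\exists e\in A^i,(d,e)\in r^i\}$; $C\sqsubseteq D$ holds if $C^i\subseteq D^i$ for all $i$; $\mathcal{T}\models C\sqsubseteq D$ is entailment over all models. Construction of $\mathcal{T}_{\mathit{rig}}$: for each concept name $C$ of $\mathcal{T}$ and each local role name $r$ of $\mathcal{T}$ introduce fresh concept names $C_r, C'_r$. (1) For each local $r$, replace every $A\sqsubseteq\exists r.B\in\mathcal{T}$ by $A\sqsubseteq\exists r.B_r$ and $B_r\sqsubseteq B$. (2) For each local $r$, replace every $\exists r.A\sqsubseteq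 B\in\mathcal{T}$ by $\exists r.A'_r\sqsubseteq B$ together with $A\sqcap C_r\sqsubseteq A'_r$ for every concept name $C$ of $\mathcal{T}$. (3) Replace each local role name $r$ of $\mathcal{T}$ by a fresh rigid role name $r'$. -}

module Defs where

open import Data.Bool using (Bool; true; false; if_then_else_)
open import Data.Integer using (ℤ; _+_; 0ℤ)
open import Data.List using (List; []; _∷_; _++_; concatMap; map)
open import Data.List.Membership.Propositional using (_∈_)
open import Data.Product using (Σ; _×_; _,_)
open import Data.Sum using (_⊎_; inj₁; inj₂)
open import Function.Bundles using (_⇔_)
open import Relation.Binary.PropositionalEquality using (_≡_)

data CI (C R : Set) : Set where
  next : C → ℤ → C → CI C R        -- A ⊑ ○ⁿ B      (○⁰B = B)
  conj : C → C → C → CI C R        -- A ⊓ A' ⊑ B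
  exL  : R → C → C → CI C R        -- ∃r.A ⊑ B
  exR  : C → R → C → CI C R        -- A ⊑ ∃r.B

TBox : Set → Set → Set
TBox C R = List (CI C R)

ciNames : {C R : Set} → CI C R → List C
ciNames (next A n B)  = A ∷ B ∷ []
ciNames (conj A A' B) = A ∷ A' ∷ B ∷ []
ciNames (exL r A B)   = A ∷ B ∷ []
ciNames (exR A r B)   = A ∷ B ∷ []

names : {C R : Set} → TBox C R → List C
names T = concatMap ciNames T

record Interp (C R : Set) (rigid : R → Bool) : Set₁ where
  field
    Δ    : Set
    conc : C → ℤ → Δ → Set
    role : R → ℤ → Δ → Δ → Set
    rigidRole : ∀ r → rigid r ≡ true → ∀ i j d e → role r i d e ⇔ role r j d e

open Interp public

_⊨ci_ : {C R : Set} {rigid : R → Bool} → Interp C R rigid → CI C R → Set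
I ⊨ci next A n B  = ∀ i d → conc I A i d → conc I B (i + n) d
I ⊨ci conj A A' B = ∀ i d → conc I A i d → conc I A' i d → conc I B i d
I ⊨ci exL r A B   = ∀ i d → (Σ (Δ I) λ e → role I r i d e × conc I A i e) → conc I B i d
I ⊨ci exR A r B   = ∀ i d → conc I A i d → Σ (Δ I) λ e → role I r i d e × conc I B i e

data _⊨T_ {C R : Set} {rigid : R → Bool} (I : Interp C R rigid) : TBox C R → Set where
  []  : I ⊨T []
  _∷_ : ∀ {α T} → I ⊨ci α → I ⊨T T → I ⊨T (α ∷ T)

Entails : {C R : Set} (rigid : R → Bool) → TBox C R → C → ℤ → C → Set₁
Entails {C} {R} rigid T A n B =
  (I : Interp C R rigid) → I ⊨T T → I ⊨ci next A n B

-- Concept names of T_rig: the original ones, and fresh names C_r, C'_r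
-- for every concept name C and role name r (only those with r local and
-- C occurring in T are actually used).
data ExtC (C R : Set) : Set where
  orig   : C → ExtC C R
  fresh  : C → R → ExtC C R
  fresh' : C → R → ExtC C R

-- Role names of T_rig: inj₁ r is an original role name (only rigid ones
-- are used), inj₂ r is the fresh rigid role name r' replacing local r.
ExtR : Set → Set
ExtR R = R ⊎ R

rigidExt : {R : Set} → (R → Bool) → ExtR R → Bool
rigidExt rigid (inj₁ r) = rigid r
rigidExt rigid (inj₂ r) = true

rigAxiom : {C R : Set} → (R → Bool) → List C → CI C R → TBox (ExtC C R) (ExtR R)
rigAxiom rigid cs (next A n B)  = next (orig A) n (orig B) ∷ []
rigAxiom rigid cs (conj A A' B) = conj (orig A) (orig A') (orig B) ∷ []
rigAxiom rigid cs (exR A r B) with rigid r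
... | true  = exR (orig A) (inj₁ r) (orig B) ∷ []
... | false = exR (orig A) (inj₂ r) (fresh B r)
            ∷ next (fresh B r) 0ℤ (orig B)
            ∷ []
rigAxiom rigid cs (exL r A B) with rigid r
... | true  = exL (inj₁ r) (orig A) (orig B) ∷ []
... | false = exL (inj₂ r) (fresh' A r) (orig B)
            ∷ map (λ C' → conj (orig A) (fresh C' r) (fresh' A r)) cs
Trig : {C R : Set} → (R → Bool) → TBox C R → TBox (ExtC C R) (ExtR R)
Trig rigid T = concatMap (rigAxiom rigid (names T)) T

-- A model J of T_rig gives a model of T on the same domain: keep the original
-- concept names, and let a local role r hold at time i on those r'-edges whose
-- target carries some marker C_r at time i.  Then A ⊑ ∃r'.B_r with B_r ⊑ B yields
-- A ⊑ ∃r.B, and the axioms A ⊓ C_r ⊑ A'_r turn ∃r'.A'_r ⊑ B into ∃r.A ⊑ B.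
-- Conversely, a model I of T is unravelled into paths along role edges of I:
-- each r-edge taken at time k becomes an r'-edge that exists at all times, and
-- the markers C_r, C'_r hold at time i exactly at paths whose last step was an
-- r-edge taken at time i, so ∃r'.A'_r ⊑ B only ever sees r-edges of the right
-- time.  Both constructions preserve the original concept names, hence the
-- two TBoxes entail the same inclusions A ⊑ ○ⁿB.
module Submission where

open import Defs
open import Data.Bool using (Bool; true; false)
open import Data.Empty using (⊥)
open import Data.Integer using (ℤ)
open import Data.Integer.Properties using (+-identityʳ)
open import Data.List using (List; []; _∷_; map; concatMap)
open import Data.List.Membership.Propositional using (_∈_)
open import Data.List.Membership.Propositional.Properties using (∈-map⁺; ∈-concat⁺′)
open import Data.List.Relation.Binary.Subset.Propositional using (_⊆_)
open import Data.List.Relation.Binary.Subset.Propositional.Properties using (⊆-refl)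
open import Data.List.Relation.Unary.All as All using (All; []; _∷_)
open import Data.List.Relation.Unary.All.Properties using (map⁺; map⁻; concat⁺; concat⁻)
open import Data.List.Relation.Unary.Any using (here; there)
open import Data.Product using (Σ; _×_; _,_; proj₁; proj₂)
open import Data.Sum using (inj₁; inj₂)
open import Function.Base using (_∘_)
open import Function.Bundles using (_⇔_; mk⇔)
open import Function.Properties.Equivalence using () renaming (refl to ⇔-refl)
open import Relation.Binary.PropositionalEquality using (_≡_; refl; subst; sym)

module _ {C R : Set} {rigid : R → Bool} {I : Interp C R rigid} where

  ⊨T⇒All : ∀ {T} → I ⊨T T → All (I ⊨ci_) T
  ⊨T⇒All []       = []
  ⊨T⇒All (h ∷ hs) = h ∷ ⊨T⇒All hs

  All⇒⊨T : ∀ {T} → All (I ⊨ci_) T → I ⊨T T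
  All⇒⊨T []       = []
  All⇒⊨T (h ∷ hs) = h ∷ All⇒⊨T hs

ciNames⊆names : {C R : Set} {T : TBox C R} {α : CI C R} →
  α ∈ T → ciNames α ⊆ names T
ciNames⊆names α∈T x∈α = ∈-concat⁺′ x∈α (∈-map⁺ ciNames α∈T)

module FromRig {C R : Set} (rigid : R → Bool) (cs : List C)
  (J : Interp (ExtC C R) (ExtR R) (rigidExt rigid)) where

  markedRole : Bool → R → ℤ → Δ J → Δ J → Set
  markedRole true  r i d e = role J (inj₁ r) i d e
  markedRole false r i d e =
    role J (inj₂ r) i d e × Σ C λ c → c ∈ cs × conc J (fresh c r) i e

  markedRole-rigid : ∀ r → rigid r ≡ true → ∀ i j d e →
    markedRole (rigid r) r i d e ⇔ markedRole (rigid r) r j d e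
  markedRole-rigid r r-rigid i j d e rewrite r-rigid =
    rigidRole J (inj₁ r) r-rigid i j d e

  interp : Interp C R rigid
  interp = record
    { Δ         = Δ J
    ; conc      = λ c → conc J (orig c)
    ; role      = λ r → markedRole (rigid r) r
    ; rigidRole = markedRole-rigid
    }

  marker⇒primed : ∀ {A r c i e} →
    All (J ⊨ci_) (map (λ C' → conj (orig A) (fresh C' r) (fresh' A r)) cs) → c ∈ cs →
    conc J (orig A) i e → conc J (fresh c r) i e → conc J (fresh' A r) i e
  marker⇒primed {i = i} {e} hs c∈cs = All.lookup (map⁻ hs) c∈cs i e

  ⊨rigAxiom⇒⊨ci : (α : CI C R) → ciNames α ⊆ cs →
    All (J ⊨ci_) (rigAxiom rigid cs α) → interp ⊨ci α
  ⊨rigAxiom⇒⊨ci (next A n B)  _ (h ∷ []) = h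
  ⊨rigAxiom⇒⊨ci (conj A A' B) _ (h ∷ []) = h
  ⊨rigAxiom⇒⊨ci (exR A r B) names⊆cs hs with rigid r | hs
  ... | true  | h ∷ [] = h
  ... | false | h ∷ marker⊑B ∷ [] = λ i d a →
    let e , re , b-marked = h i d a
        b = subst (λ j → conc J (orig B) j e) (+-identityʳ i) (marker⊑B i e b-marked)
    in  e , (re , B , names⊆cs (there (here refl)) , b-marked) , b
  ⊨rigAxiom⇒⊨ci (exL r A B) _ hs with rigid r | hs
  ... | true  | h ∷ [] = h
  ... | false | h ∷ conjs = λ i d (e , (re , c , c∈cs , c-marked) , a) →
    h i d (e , re , marker⇒primed conjs c∈cs a c-marked)

  ⊨Trig⇒⊨T : ∀ T → names T ⊆ cs →
    J ⊨T concatMap (rigAxiom rigid cs) T → interp ⊨T T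
  ⊨Trig⇒⊨T T names⊆cs J⊨ = All⇒⊨T (All.tabulate λ α∈T →
    ⊨rigAxiom⇒⊨ci _ (names⊆cs ∘ ciNames⊆names α∈T) (All.lookup J⊨rigAxioms α∈T))
    where
    J⊨rigAxioms : All (λ α → All (J ⊨ci_) (rigAxiom rigid cs α)) T
    J⊨rigAxioms = map⁻ (concat⁻ (⊨T⇒All J⊨))

module Unravel {C R : Set} (rigid : R → Bool) (I : Interp C R rigid) where

  -- Steps are stored most recent first.
  Step : Set
  Step = R × ℤ × Δ I

  Path : Set
  Path = Δ I × List Step

  last : Path → Δ I
  last (d , [])              = d
  last (_ , (_ , _ , e) ∷ _) = e

  LastStepAt : R → ℤ → Path → Set
  LastStepAt r i (_ , [])               = ⊥
  LastStepAt r i (_ , (r' , k , _) ∷ _) = r' ≡ r × k ≡ i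

  extend : Path → Step → Path
  extend p s = proj₁ p , s ∷ proj₂ p

  data _─[_]→_ : Path → R → Path → Set where
    step : ∀ {p r k e} → role I r k (last p) e → p ─[ r ]→ extend p (r , k , e)

  concU : ExtC C R → ℤ → Path → Set
  concU (orig A)     i p = conc I A i (last p)
  concU (fresh A r)  i p = conc I A i (last p) × LastStepAt r i p
  concU (fresh' A r) i p = conc I A i (last p) × LastStepAt r i p

  roleU : ExtR R → ℤ → Path → Path → Set
  roleU (inj₁ r) i p q = role I r i (last p) (last q)
  roleU (inj₂ r) _ p q = p ─[ r ]→ q

  roleU-rigid : ∀ r → rigidExt rigid r ≡ true → ∀ i j p q →
    roleU r i p q ⇔ roleU r j p q
  roleU-rigid (inj₁ r) r-rigid i j p q = rigidRole I r r-rigid i j (last p) (last q)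
  roleU-rigid (inj₂ r) _       i j p q = ⇔-refl

  interp : Interp (ExtC C R) (ExtR R) (rigidExt rigid)
  interp = record { Δ = Path ; conc = concU ; role = roleU ; rigidRole = roleU-rigid }

  ⊨ci⇒⊨rigAxiom : ∀ cs (α : CI C R) → I ⊨ci α → All (interp ⊨ci_) (rigAxiom rigid cs α)
  ⊨ci⇒⊨rigAxiom cs (next A n B)  h = (λ i p → h i (last p)) ∷ []
  ⊨ci⇒⊨rigAxiom cs (conj A A' B) h = (λ i p → h i (last p)) ∷ []
  ⊨ci⇒⊨rigAxiom cs (exR A r B) h with rigid r
  ... | true  = (λ i p a → let e , re , b = h i (last p) a in (e , []) , re , b) ∷ []
  ... | false =
        (λ i p a → let e , re , b = h i (last p) a in
                   extend p (r , i , e) , step re , b , refl , refl)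
      ∷ (λ i q (b , _) → subst (λ j → conc I B j (last q)) (sym (+-identityʳ i)) b)
      ∷ []
  ⊨ci⇒⊨rigAxiom cs (exL r A B) h with rigid r
  ... | true  = (λ i p (q , re , a) → h i (last p) (last q , re , a)) ∷ []
  ... | false = (λ { i p (_ , step re , a , refl , refl) → h i (last p) (_ , re , a) })
              ∷ map⁺ (All.universal (λ _ i q a (_ , last-r-at-i) → a , last-r-at-i) cs)

  ⊨T⇒⊨Trig : ∀ cs T → I ⊨T T → interp ⊨T concatMap (rigAxiom rigid cs) T
  ⊨T⇒⊨Trig cs T I⊨ =
    All⇒⊨T (concat⁺ (map⁺ (All.map (⊨ci⇒⊨rigAxiom cs _) (⊨T⇒All I⊨))))

lemma1 : {C R : Set} (rigid : R → Bool) (T : TBox C R) (A B : C) (n : ℤ) →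
    A ∈ names T → B ∈ names T →
    Entails rigid T A n B ⇔ Entails (rigidExt rigid) (Trig rigid T) (orig A) n (orig B)
lemma1 rigid T A B n _ _ = mk⇔
  (λ T⊨ J J⊨ → T⊨ (FromRig.interp rigid (names T) J)
                  (FromRig.⊨Trig⇒⊨T rigid (names T) J T ⊆-refl J⊨))
  (λ Trig⊨ I I⊨ i d → Trig⊨ (Unravel.interp rigid I)
                            (Unravel.⊨T⇒⊨Trig rigid I (names T) T I⊨) i (d , []))
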